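{- Let $A$ be a normalised finite subset of $\mathbb{Z}$ and $n>0$ an integer, and suppose $A$ is reducible modulo $n$ with reduction $A'\subseteq\mathbb{Z}/n\mathbb{Z}$. Let $f(n,A)=|A'+A'|-|A'-A'|$, where the sumset and difference set of $A'$ are computed in $\mathbb{Z}/n\mathbb{Z}$. Put $B=A\cup(A+n)$, where $A+n=\{x+n : x\in A\}$. Then $B$ is a normalised subset of $\mathbb{Z}$ and $$|B+B|-|B-B|=(|A+A|-|A-A|)+2f(n,A).$$
   Context: For a subset $S$ of an abelian group, $S+S=\{s_1+s_2: s_1,s_2\in S\}$ and $S-S=\{s_1-s_2 : s_1,s_2\in S\}$. A finite set $A\subseteq\mathbb{Z}$ is normalised if its smallest element is $0$ and the greatest common divisor of its elements is $1$. If $A$ is a normalised subset of $\mathbb{Z}$ with largest element $m$ and $n>0$ is an integer, the reduction of $A$ modulo $n$ is $A'=A\cap[0,n)$ viewed as a subset of $\mathbb{Z}/n\mathbb{Z}$ via the natural map; $A$ is called reducible modulo $n$ if $A=\{x\in\mathbb{Z} : 0\le x\le m,\ x \bmod n\in A'\}$. -}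

module Defs where

open import Level using (Level)
open import Data.Nat as ℕ using (ℕ; NonZero)
open import Data.Nat.GCD using (gcd)
open import Data.Integer using (ℤ; +_; _+_; _-_; _≤_; _<_; ∣_∣)
open import Data.Integer.DivMod using (_%ℕ_)
open import Data.List using (List; foldr; map; _++_; length)
open import Data.List.Membership.Propositional using (_∈_)
open import Data.List.Relation.Unary.Unique.Propositional using (Unique)
open import Data.Product using (Σ; ∃; ∃-syntax; _×_)
open import Function.Bundles using (_⇔_)
open import Relation.Binary.PropositionalEquality using (_≡_)

-- A finite subset of ℤ is given by a list of its elements (duplicates allowed;
-- the set is the set of list members).

HasSize : {X : Set} → (X → Set) → ℕ → Set
HasSize {X} P k = Σ (List X) λ L → Unique L × (∀ x → (x ∈ L) ⇔ P x) × length L ≡ k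

SumSet : List ℤ → ℤ → Set
SumSet A z = ∃[ x ] ∃[ y ] (x ∈ A × y ∈ A × z ≡ x + y)

DiffSet : List ℤ → ℤ → Set
DiffSet A z = ∃[ x ] ∃[ y ] (x ∈ A × y ∈ A × z ≡ x - y)

gcdList : List ℤ → ℕ
gcdList = foldr (λ x g → gcd ∣ x ∣ g) 0

Normalised : List ℤ → Set
Normalised A = (+ 0 ∈ A) × (∀ x → x ∈ A → + 0 ≤ x) × gcdList A ≡ 1

IsLargest : ℤ → List ℤ → Set
IsLargest m A = (m ∈ A) × (∀ x → x ∈ A → x ≤ m)

-- ℤ/nℤ is represented by canonical residues 0,…,n-1 (as natural numbers);
-- the natural map ℤ → ℤ/nℤ is x ↦ x %ℕ n.
-- The reduction A' = A ∩ [0,n) viewed in ℤ/nℤ.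
Reduction : List ℤ → (n : ℕ) → .{{NonZero n}} → ℕ → Set
Reduction A n r = ∃[ a ] (a ∈ A × + 0 ≤ a × a < + n × r ≡ a %ℕ n)

ReducibleMod : List ℤ → (n : ℕ) → .{{NonZero n}} → Set
ReducibleMod A n = ∀ m → IsLargest m A →
  ∀ x → (x ∈ A) ⇔ (+ 0 ≤ x × x ≤ m × Reduction A n (x %ℕ n))

ModSumSet : List ℤ → (n : ℕ) → .{{NonZero n}} → ℕ → Set
ModSumSet A n t = ∃[ r ] ∃[ s ] (Reduction A n r × Reduction A n s × t ≡ (+ r + + s) %ℕ n)

ModDiffSet : List ℤ → (n : ℕ) → .{{NonZero n}} → ℕ → Set
ModDiffSet A n t = ∃[ r ] ∃[ s ] (Reduction A n r × Reduction A n s × t ≡ (+ r - + s) %ℕ n)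

shift : ℤ → List ℤ → List ℤ
shift c A = map (_+ c) A

doubleSet : List ℤ → ℕ → List ℤ
doubleSet A n = A ++ shift (+ n) A

-- Write S = A + A and D = A - A. Then B + B = S ∪ (S + n) ∪ (S + 2n) and
-- B - B = D ∪ (D + n) ∪ (D - n). Reducibility of A makes S and D convex along the
-- residue classes mod n: if x < y lie in the same class, then x + n is in the set too
-- (push a summand of x up by n inside A; if neither summand can move, both are within n
-- of max A, which squeezes y to x + n). So every residue class of S is a progression of
-- step n, and adding its two translates contributes exactly two new elements per class:
-- |B + B| = |S| + 2|A' + A'|. The same holds for D, with |A' - A'| classes.
module Submission where

open import Defs
open import Data.Nat as ℕ using (ℕ; NonZero; suc)
import Data.Nat.Properties as ℕₚ
open import Data.Nat.Divisibility using (_∣_; ∣-trans; _∣0; ∣1⇒≡1)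
open import Data.Nat.GCD using (gcd[m,n]∣m; gcd[m,n]∣n; gcd-greatest)
open import Data.Integer as ℤ
  using (ℤ; +_; -[1+_]; +[1+_]; _+_; _-_; _*_; -_; ∣_∣; _≤_; _<_; +≤+; +<+; -≤+; _≤?_)
open import Data.Integer.Properties
open import Data.Integer.DivMod using (_%ℕ_; _/ℕ_; a≡a%ℕn+[a/ℕn]*n; n%ℕd<d)
open import Data.Integer.Tactic.RingSolver using (solve-∀)
open import Data.List using (List; []; _∷_; map; filter; _++_)
open import Data.List.Properties using (length-map; length-++)
open import Data.List.Membership.Propositional using (_∈_)
open import Data.List.Membership.Propositional.Properties
  using (∈-map⁺; ∈-map⁻; ∈-++⁺ˡ; ∈-++⁺ʳ; ∈-++⁻; ++-∈⇔; ∈-filter⁺; ∈-filter⁻)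
open import Data.List.Membership.Propositional.Properties.WithK using (unique∧set⇒bag)
open import Data.List.Relation.Binary.BagAndSetEquality using (∼bag⇒↭)
open import Data.List.Relation.Binary.Permutation.Propositional.Properties using (↭-length)
import Data.List.Relation.Unary.All as All
import Data.List.Relation.Unary.All.Properties as All
open import Data.List.Relation.Unary.Any using (here; there)
open import Data.List.Relation.Unary.Unique.Propositional using (Unique; []; _∷_)
import Data.List.Relation.Unary.Unique.Propositional.Properties as Unique
open import Data.List.Extrema ≤-totalOrder using (max; argmax-all; xs≤max)
open import Data.Product using (_×_; ∃-syntax; _,_; proj₁; proj₂)
open import Data.Sum as Sum using (_⊎_; inj₁; inj₂)
open import Data.Sum.Function.Propositional using (_⊎-⇔_)
open import Function.Base using (id; _∘_)
open import Function.Bundles using (_⇔_; mk⇔; Equivalence)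
open import Function.Properties.Equivalence using () renaming (trans to ⇔-trans; sym to ⇔-sym)
open import Relation.Nullary using (¬_; yes; no; ¬?; contradiction)
import Relation.Nullary.Decidable as Dec
open import Relation.Unary using (Decidable)
open import Relation.Binary.Definitions using (DecidableEquality; tri<; tri≈; tri>)
open import Relation.Binary.PropositionalEquality
  using (_≡_; _≢_; refl; sym; trans; cong; cong₂; subst; module ≡-Reasoning)

Unique-map⁺ : {X Y : Set} (f : X → Y) {xs : List X} →
              (∀ {x y} → x ∈ xs → y ∈ xs → f x ≡ f y → x ≡ y) → Unique xs → Unique (map f xs)
Unique-map⁺ f {[]} _ [] = []
Unique-map⁺ f {x ∷ xs} injective (x∉xs ∷ xs!) =
  All.map⁺ (All.tabulate λ y∈xs fx≡fy → All.lookup x∉xs y∈xs (injective (here refl) (there y∈xs) fx≡fy))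
  ∷ Unique-map⁺ f (λ x∈xs y∈xs → injective (there x∈xs) (there y∈xs)) xs!

module _ {X : Set} {P : X → Set} where

  HasSize-unique : ∀ {k l} → HasSize P k → HasSize P l → k ≡ l
  HasSize-unique (L , L! , L⇔P , refl) (M , M! , M⇔P , refl) =
    ↭-length (∼bag⇒↭ (unique∧set⇒bag L! M! λ {x} → ⇔-trans (L⇔P x) (⇔-sym (M⇔P x))))

  HasSize-cong : ∀ {Q : X → Set} {k} → (∀ x → P x ⇔ Q x) → HasSize P k → HasSize Q k
  HasSize-cong P⇔Q (L , L! , L⇔P , length≡k) = L , L! , (λ x → ⇔-trans (L⇔P x) (P⇔Q x)) , length≡k

  HasSize⇒Decidable : DecidableEquality X → ∀ {k} → HasSize P k → Decidable P
  HasSize⇒Decidable _≟_ (L , _ , L⇔P , _) x = Dec.map (L⇔P x) (x ∈? L)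
    where open import Data.List.Membership.DecPropositional _≟_ using (_∈?_)

  HasSize-∩ : ∀ {Q : X → Set} → Decidable Q → ∀ {k} → HasSize P k → ∃[ l ] HasSize (λ x → P x × Q x) l
  HasSize-∩ {Q} Q? (L , L! , L⇔P , _) =
    _ , filter Q? L , Unique.filter⁺ Q? L! , (λ x → mk⇔ (to x) (from x)) , refl
    where
    to : ∀ x → x ∈ filter Q? L → P x × Q x
    to x x∈ with ∈-filter⁻ Q? x∈
    ... | x∈L , Qx = Equivalence.to (L⇔P x) x∈L , Qx
    from : ∀ x → P x × Q x → x ∈ filter Q? L
    from x (Px , Qx) = ∈-filter⁺ Q? (Equivalence.from (L⇔P x) Px) Qx

  HasSize-⊎ : ∀ {Q : X → Set} {k l} → HasSize P k → HasSize Q l → (∀ {x} → P x → ¬ Q x) →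
              HasSize (λ x → P x ⊎ Q x) (k ℕ.+ l)
  HasSize-⊎ (L , L! , L⇔P , refl) (M , M! , M⇔Q , refl) disjoint =
    L ++ M ,
    Unique.++⁺ L! M! (λ (x∈L , x∈M) → disjoint (Equivalence.to (L⇔P _) x∈L)
                                               (Equivalence.to (M⇔Q _) x∈M)) ,
    (λ x → ⇔-trans ++-∈⇔ (L⇔P x ⊎-⇔ M⇔Q x)) ,
    length-++ L

HasSize-image : {X Y : Set} {P : X → Set} {Q : Y → Set} {k : ℕ} (f : X → Y) → HasSize P k →
                (∀ {x} → P x → Q (f x)) → (∀ {x y} → P x → P y → f x ≡ f y → x ≡ y) →
                (∀ {y} → Q y → ∃[ x ] (P x × f x ≡ y)) → HasSize Q k
HasSize-image {P = P} {Q} f (L , L! , L⇔P , refl) into injective onto =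
  map f L , Unique-map⁺ f (λ x∈ y∈ → injective (inP x∈) (inP y∈)) L! ,
  (λ y → mk⇔ (to y) (from y)) , length-map f L
  where
  inP : ∀ {x} → x ∈ L → P x
  inP = Equivalence.to (L⇔P _)
  to : ∀ y → y ∈ map f L → Q y
  to y y∈ with ∈-map⁻ f y∈
  ... | x , x∈ , refl = into (inP x∈)
  from : ∀ y → Q y → y ∈ map f L
  from y Qy with onto Qy
  ... | x , Px , refl = ∈-map⁺ f (Equivalence.from (L⇔P x) Px)

i-j+j≡i : ∀ i j → i - j + j ≡ i
i-j+j≡i = solve-∀

i+j-j≡i : ∀ i j → i + j - j ≡ i
i+j-j≡i = solve-∀

i-j≡k⇒i≡k+j : ∀ {i j k} → i - j ≡ k → i ≡ k + j
i-j≡k⇒i≡k+j {i} {j} i-j≡k = trans (sym (i-j+j≡i i j)) (cong (_+ j) i-j≡k)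

i+j≡k⇒i≡k-j : ∀ {i j k} → i + j ≡ k → i ≡ k - j
i+j≡k⇒i≡k-j {i} {j} i+j≡k = trans (sym (i+j-j≡i i j)) (cong (_- j) i+j≡k)

HasSize-translate : ∀ {P : ℤ → Set} {k} c → HasSize P k → HasSize (λ z → P (z + c)) k
HasSize-translate {P} c hP = HasSize-image (_- c) hP
  (λ {x} Px → subst P (sym (i-j+j≡i x c)) Px)
  (λ {y = y} _ _ x-c≡y-c → trans (i-j≡k⇒i≡k+j x-c≡y-c) (i-j+j≡i y c))
  (λ {y} Py+c → y + c , Py+c , i+j-j≡i y c)

max-IsLargest : ∀ {x} A → x ∈ A → IsLargest (max x A) A
max-IsLargest {x} A x∈A = argmax-all id {P = _∈ A} x∈A (All.tabulate id) , λ _ → All.lookup (xs≤max x A)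

gcdList-++-∣ : ∀ xs ys → gcdList (xs ++ ys) ∣ gcdList xs
gcdList-++-∣ [] ys = gcdList ys ∣0
gcdList-++-∣ (x ∷ xs) ys =
  gcd-greatest (gcd[m,n]∣m ∣ x ∣ _) (∣-trans (gcd[m,n]∣n ∣ x ∣ _) (gcdList-++-∣ xs ys))

doubleSet-normalised : ∀ A n → Normalised A → Normalised (doubleSet A n)
doubleSet-normalised A n (0∈A , A≥0 , gcdA≡1) = ∈-++⁺ˡ 0∈A , B≥0 , gcdB≡1
  where
  B≥0 : ∀ x → x ∈ doubleSet A n → + 0 ≤ x
  B≥0 x x∈B with ∈-++⁻ A x∈B
  ... | inj₁ x∈A = A≥0 x x∈A
  ... | inj₂ x∈A+n with ∈-map⁻ (_+ + n) x∈A+n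
  ...   | a , a∈A , refl = ≤-trans (A≥0 a a∈A) (i≤i+j a (+ n))
  gcdB≡1 : gcdList (doubleSet A n) ≡ 1
  gcdB≡1 = ∣1⇒≡1 (subst (gcdList (doubleSet A n) ∣_) gcdA≡1 (gcdList-++-∣ A (shift (+ n) A)))

module Modulo (n : ℕ) .{{_ : NonZero n}} where

  N : ℤ
  N = + n

  i<i+N : ∀ i → i < i + N
  i<i+N i = subst (_< i + N) (+-identityʳ i) (+-monoʳ-< i (+<+ (ℕ.>-nonZero⁻¹ n)))

  i-N<i : ∀ i → i - N < i
  i-N<i i = subst (i - N <_) (i-j+j≡i i N) (i<i+N (i - N))

  division : ∀ a → a ≡ + (a %ℕ n) + (a /ℕ n) * N
  division a = a≡a%ℕn+[a/ℕn]*n a n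

  private
    ≢+[1+k]*N : ∀ {r s} k → r ℕ.< n → + r ≢ + s + +[1+ k ] * N
    ≢+[1+k]*N {r} {s} k r<n r≡s+[1+k]N =
      ℕₚ.<⇒≱ r<n (subst (n ℕ.≤_) (sym r≡) (ℕₚ.≤-trans (ℕₚ.m≤n*m n (suc k)) (ℕₚ.m≤n+m _ s)))
      where
      r≡ : r ≡ s ℕ.+ suc k ℕ.* n
      r≡ = +-injective (trans r≡s+[1+k]N (cong (_+_ (+ s)) (sym (pos-* (suc k) n))))

    move-multiples : ∀ x y p q → x + p * N ≡ y + q * N → x ≡ y + (q - p) * N
    move-multiples x y p q eq =
      trans (sym (i+j-j≡i x (p * N))) (trans (cong (_- p * N) eq) (distrib y q p N))
      where
      distrib : ∀ y q p N → y + q * N - p * N ≡ y + (q - p) * N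
      distrib = solve-∀

  remainder-unique : ∀ {r s} d → r ℕ.< n → s ℕ.< n → + r ≡ + s + d * N → r ≡ s
  remainder-unique (+ 0) _ _ r≡s = +-injective (trans r≡s (+-identityʳ _))
  remainder-unique +[1+ k ] r<n _ r≡s+dN = contradiction r≡s+dN (≢+[1+k]*N k r<n)
  remainder-unique {r} {s} -[1+ k ] _ s<n r≡s+dN = contradiction s≡r+[1+k]N (≢+[1+k]*N k s<n)
    where
    s≡r+[1+k]N : + s ≡ + r + +[1+ k ] * N
    s≡r+[1+k]N = move-multiples (+ s) (+ r) -[1+ k ] (+ 0) (trans (sym r≡s+dN) (sym (+-identityʳ (+ r))))

  %ℕ-unique : ∀ {r} a q → r ℕ.< n → a ≡ + r + q * N → a %ℕ n ≡ r
  %ℕ-unique {r} a q r<n a≡r+qN = remainder-unique (q - a /ℕ n) (n%ℕd<d a n) r<n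
    (move-multiples (+ (a %ℕ n)) (+ r) (a /ℕ n) q (trans (sym (division a)) a≡r+qN))

  [i+k*N]%ℕn≡i%ℕn : ∀ i k → (i + k * N) %ℕ n ≡ i %ℕ n
  [i+k*N]%ℕn≡i%ℕn i k = %ℕ-unique (i + k * N) (i /ℕ n + k) (n%ℕd<d i n) (begin
    i + k * N                           ≡⟨ cong (_+ k * N) (division i) ⟩
    + (i %ℕ n) + (i /ℕ n) * N + k * N   ≡⟨ regroup (+ (i %ℕ n)) (i /ℕ n) k N ⟩
    + (i %ℕ n) + (i /ℕ n + k) * N       ∎)
    where
    open ≡-Reasoning
    regroup : ∀ r q k N → r + q * N + k * N ≡ r + (q + k) * N
    regroup = solve-∀

  [i+N]%ℕn≡i%ℕn : ∀ i → (i + N) %ℕ n ≡ i %ℕ n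
  [i+N]%ℕn≡i%ℕn i = trans (cong (λ t → (i + t) %ℕ n) (sym (*-identityˡ N))) ([i+k*N]%ℕn≡i%ℕn i (+ 1))

  [i-N]%ℕn≡i%ℕn : ∀ i → (i - N) %ℕ n ≡ i %ℕ n
  [i-N]%ℕn≡i%ℕn i = trans (cong (λ t → (i + t) %ℕ n) (sym (-1*i≡-i N))) ([i+k*N]%ℕn≡i%ℕn i (- + 1))

  [i+j]%ℕn≡[i%ℕn+j%ℕn]%ℕn : ∀ i j → (i + j) %ℕ n ≡ (+ (i %ℕ n) + + (j %ℕ n)) %ℕ n
  [i+j]%ℕn≡[i%ℕn+j%ℕn]%ℕn i j =
    trans (cong (_%ℕ n) i+j≡) ([i+k*N]%ℕn≡i%ℕn (+ (i %ℕ n) + + (j %ℕ n)) (i /ℕ n + j /ℕ n))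
    where
    regroup : ∀ a b c d N → (a + b * N) + (c + d * N) ≡ (a + c) + (b + d) * N
    regroup = solve-∀
    i+j≡ : i + j ≡ + (i %ℕ n) + + (j %ℕ n) + (i /ℕ n + j /ℕ n) * N
    i+j≡ = trans (cong₂ _+_ (division i) (division j))
                 (regroup (+ (i %ℕ n)) (i /ℕ n) (+ (j %ℕ n)) (j /ℕ n) N)

  [i-j]%ℕn≡[i%ℕn-j%ℕn]%ℕn : ∀ i j → (i - j) %ℕ n ≡ (+ (i %ℕ n) - + (j %ℕ n)) %ℕ n
  [i-j]%ℕn≡[i%ℕn-j%ℕn]%ℕn i j =
    trans (cong (_%ℕ n) i-j≡) ([i+k*N]%ℕn≡i%ℕn (+ (i %ℕ n) - + (j %ℕ n)) (i /ℕ n - j /ℕ n))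
    where
    regroup : ∀ a b c d N → (a + b * N) - (c + d * N) ≡ (a - c) + (b - d) * N
    regroup = solve-∀
    i-j≡ : i - j ≡ + (i %ℕ n) - + (j %ℕ n) + (i /ℕ n - j /ℕ n) * N
    i-j≡ = trans (cong₂ _-_ (division i) (division j))
                 (regroup (+ (i %ℕ n)) (i /ℕ n) (+ (j %ℕ n)) (j /ℕ n) N)

  %ℕ≡⇒multiple : ∀ {x y} → x %ℕ n ≡ y %ℕ n → y ≡ x + (y /ℕ n - x /ℕ n) * N
  %ℕ≡⇒multiple {x} {y} x≡y = begin
    y                                                  ≡⟨ division y ⟩
    + (y %ℕ n) + (y /ℕ n) * N                          ≡⟨ cong (λ r → + r + (y /ℕ n) * N) (sym x≡y) ⟩
    + (x %ℕ n) + (y /ℕ n) * N                          ≡⟨ regroup (+ (x %ℕ n)) (x /ℕ n) (y /ℕ n) N ⟩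
    + (x %ℕ n) + (x /ℕ n) * N + (y /ℕ n - x /ℕ n) * N
      ≡⟨ cong (_+ (y /ℕ n - x /ℕ n) * N) (sym (division x)) ⟩
    x + (y /ℕ n - x /ℕ n) * N                          ∎
    where
    open ≡-Reasoning
    regroup : ∀ r p q N → r + q * N ≡ r + p * N + (q - p) * N
    regroup = solve-∀

  private
    N≤+[1+k]*N : ∀ k → N ≤ +[1+ k ] * N
    N≤+[1+k]*N k = subst (N ≤_) (pos-* (suc k) n) (+≤+ {n} {suc k ℕ.* n} (ℕₚ.m≤n*m n (suc k)))

    i+-[1+k]*N≤i : ∀ i k → i + -[1+ k ] * N ≤ i
    i+-[1+k]*N≤i i k =
      ≤-trans (+-monoʳ-≤ i (*-monoʳ-≤-nonNeg N (-≤+ {k} {0}))) (≤-reflexive (+-identityʳ i))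

  %ℕ≡⇒+N≤ : ∀ {x y} → x < y → x %ℕ n ≡ y %ℕ n → x + N ≤ y
  %ℕ≡⇒+N≤ {x} {y} x<y x≡y with y /ℕ n - x /ℕ n | %ℕ≡⇒multiple {x} {y} x≡y
  ... | + 0      | refl = contradiction (sym (+-identityʳ x)) (<⇒≢ x<y)
  ... | +[1+ k ] | refl = +-monoʳ-≤ x (N≤+[1+k]*N k)
  ... | -[1+ k ] | refl = contradiction (i+-[1+k]*N≤i x k) (<⇒≱ x<y)

  %ℕ≡⇒≡+N : ∀ {x y} → x < y → x %ℕ n ≡ y %ℕ n → y < x + N + N → y ≡ x + N
  %ℕ≡⇒≡+N {x} {y} x<y x≡y y<x+2N with x + N ℤ.≟ y
  ... | yes x+N≡y = sym x+N≡y
  ... | no x+N≢y  = contradiction x+2N≤y (<⇒≱ y<x+2N)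
    where
    x+2N≤y : x + N + N ≤ y
    x+2N≤y = %ℕ≡⇒+N≤ (≤∧≢⇒< (%ℕ≡⇒+N≤ x<y x≡y) x+N≢y) (trans ([i+N]%ℕn≡i%ℕn x) x≡y)

  -- Every residue class of a convex set is a run of consecutive terms of step N.
  Convex : (ℤ → Set) → Set
  Convex P = ∀ {x y} → P x → P y → x < y → x %ℕ n ≡ y %ℕ n → P (x + N)

  Top : (ℤ → Set) → ℤ → Set
  Top P z = P z × ¬ P (z + N)

  ResidueSet : (ℤ → Set) → ℕ → Set
  ResidueSet P t = ∃[ z ] (P z × z %ℕ n ≡ t)

  Thick : (ℤ → Set) → ℤ → Set
  Thick P z = P z ⊎ P (z - N) ⊎ P (z - N - N)

  module _ {P : ℤ → Set} where

    HasSize-Top : ∀ {k} → HasSize P k → ∃[ u ] HasSize (Top P) u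
    HasSize-Top hP = HasSize-∩ (λ z → ¬? (HasSize⇒Decidable ℤ._≟_ hP (z + N))) hP

    top-exists : ∀ {k z} → HasSize P k → P z → ∃[ w ] (Top P w × w %ℕ n ≡ z %ℕ n)
    top-exists {z = z} (L , _ , L⇔P , _) Pz = w , (proj₁ Pw×w≡z , ¬Pw+N) , proj₂ Pw×w≡z
      where
      sameClass? : Decidable (λ w → w %ℕ n ≡ z %ℕ n)
      sameClass? w = w %ℕ n ℕ.≟ z %ℕ n
      C : List ℤ
      C = filter sameClass? L
      w : ℤ
      w = max z C
      Pw×w≡z : P w × w %ℕ n ≡ z %ℕ n
      Pw×w≡z = argmax-all id (Pz , refl) (All.tabulate λ v∈C →
        let v∈L , v≡z = ∈-filter⁻ sameClass? v∈C in Equivalence.to (L⇔P _) v∈L , v≡z)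
      ¬Pw+N : ¬ P (w + N)
      ¬Pw+N Pw+N = <⇒≱ (i<i+N w) (All.lookup (xs≤max z C)
        (∈-filter⁺ sameClass? (Equivalence.from (L⇔P _) Pw+N) (trans ([i+N]%ℕn≡i%ℕn w) (proj₂ Pw×w≡z))))

    Top-injective : Convex P → ∀ {x y} → Top P x → Top P y → x %ℕ n ≡ y %ℕ n → x ≡ y
    Top-injective convex {x} {y} (Px , ¬Px+N) (Py , ¬Py+N) x≡y with <-cmp x y
    ... | tri< x<y _ _ = contradiction (convex Px Py x<y x≡y) ¬Px+N
    ... | tri≈ _ x≡y _ = x≡y
    ... | tri> _ _ y<x = contradiction (convex Py Px y<x (sym x≡y)) ¬Py+N

    HasSize-ResidueSet : Convex P → ∀ {k u} → HasSize P k → HasSize (Top P) u → HasSize (ResidueSet P) u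
    HasSize-ResidueSet convex hP hTop = HasSize-image (_%ℕ n) hTop
      (λ {z} (Pz , _) → z , Pz , refl) (Top-injective convex) (λ { (z , Pz , refl) → top-exists hP Pz })

    Thick⇔ : Decidable P → ∀ z → Thick P z ⇔ (P z ⊎ Top P (z - N) ⊎ Top P (z - N - N))
    Thick⇔ P? z = mk⇔ split (Sum.map₂ (Sum.map proj₁ proj₁))
      where
      top-below : ∀ {w} → ¬ P w → P (w - N) → Top P (w - N)
      top-below {w} ¬Pw Pw-N = Pw-N , ¬Pw ∘ subst P (i-j+j≡i w N)
      split : Thick P z → P z ⊎ Top P (z - N) ⊎ Top P (z - N - N)
      split thick with P? z
      ... | yes Pz = inj₁ Pz
      ... | no ¬Pz with thick
      ...   | inj₁ Pz = contradiction Pz ¬Pz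
      ...   | inj₂ (inj₁ Pz-N) = inj₂ (inj₁ (top-below ¬Pz Pz-N))
      ...   | inj₂ (inj₂ Pz-2N) with P? (z - N)
      ...     | yes Pz-N = inj₂ (inj₁ (top-below ¬Pz Pz-N))
      ...     | no ¬Pz-N = inj₂ (inj₂ (top-below ¬Pz-N Pz-2N))

    HasSize-Thick : Convex P → ∀ {k u} → HasSize P k → HasSize (Top P) u →
                    HasSize (Thick P) (k ℕ.+ (u ℕ.+ u))
    HasSize-Thick convex {u = u} hP hTop =
      HasSize-cong (λ z → ⇔-sym (Thick⇔ (HasSize⇒Decidable ℤ._≟_ hP) z))
        (HasSize-⊎ hP (HasSize-⊎ hTop₁ hTop₂ (λ {z} → disjoint₁₂ {z})) (λ {z} → disjoint₀ {z}))
      where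
      hTop₁ : HasSize (λ z → Top P (z - N)) u
      hTop₁ = HasSize-translate (- N) hTop
      hTop₂ : HasSize (λ z → Top P (z - N - N)) u
      hTop₂ = HasSize-translate (- N) hTop₁
      disjoint₁₂ : ∀ {z} → Top P (z - N) → ¬ Top P (z - N - N)
      disjoint₁₂ {z} (Pz-N , _) (_ , ¬Pz-N) = ¬Pz-N (subst P (sym (i-j+j≡i (z - N) N)) Pz-N)
      disjoint₀ : ∀ {z} → P z → ¬ (Top P (z - N) ⊎ Top P (z - N - N))
      disjoint₀ {z} Pz (inj₁ (_ , ¬Pz)) = ¬Pz (subst P (sym (i-j+j≡i z N)) Pz)
      disjoint₀ {z} Pz (inj₂ (Pz-2N , ¬Pz-N)) =
        ¬Pz-N (convex Pz-2N Pz (<-trans (i-N<i (z - N)) (i-N<i z))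
                                (trans ([i-N]%ℕn≡i%ℕn (z - N)) ([i-N]%ℕn≡i%ℕn z)))

  module _ {A : List ℤ} where

    ∈-doubleSet⁻ : ∀ {b} → b ∈ doubleSet A n → b ∈ A ⊎ ∃[ a ] (a ∈ A × b ≡ a + N)
    ∈-doubleSet⁻ = Sum.map₂ (∈-map⁻ (_+ N)) ∘ ∈-++⁻ A

    ∈-doubleSet⁺ʳ : ∀ {a} → a ∈ A → a + N ∈ doubleSet A n
    ∈-doubleSet⁺ʳ = ∈-++⁺ʳ A ∘ ∈-map⁺ (_+ N)

    SumSet-doubleSet : ∀ z → SumSet (doubleSet A n) z ⇔ Thick (SumSet A) z
    SumSet-doubleSet z = mk⇔ to from
      where
      to : SumSet (doubleSet A n) z → Thick (SumSet A) z
      to (x , y , x∈ , y∈ , refl) with ∈-doubleSet⁻ x∈ | ∈-doubleSet⁻ y∈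
      ... | inj₁ x∈A | inj₁ y∈A = inj₁ (x , y , x∈A , y∈A , refl)
      ... | inj₁ x∈A | inj₂ (b , b∈A , refl) = inj₂ (inj₁ (x , b , x∈A , b∈A , eq x b N))
        where
        eq : ∀ x b N → x + (b + N) - N ≡ x + b
        eq = solve-∀
      ... | inj₂ (a , a∈A , refl) | inj₁ y∈A = inj₂ (inj₁ (a , y , a∈A , y∈A , eq a y N))
        where
        eq : ∀ a y N → a + N + y - N ≡ a + y
        eq = solve-∀
      ... | inj₂ (a , a∈A , refl) | inj₂ (b , b∈A , refl) = inj₂ (inj₂ (a , b , a∈A , b∈A , eq a b N))
        where
        eq : ∀ a b N → a + N + (b + N) - N - N ≡ a + b
        eq = solve-∀
      from : Thick (SumSet A) z → SumSet (doubleSet A n) z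
      from (inj₁ (a , b , a∈A , b∈A , z≡)) = a , b , ∈-++⁺ˡ a∈A , ∈-++⁺ˡ b∈A , z≡
      from (inj₂ (inj₁ (a , b , a∈A , b∈A , z-N≡))) =
        a + N , b , ∈-doubleSet⁺ʳ a∈A , ∈-++⁺ˡ b∈A , trans (i-j≡k⇒i≡k+j z-N≡) (eq a b N)
        where
        eq : ∀ a b N → a + b + N ≡ a + N + b
        eq = solve-∀
      from (inj₂ (inj₂ (a , b , a∈A , b∈A , z-2N≡))) =
        a + N , b + N , ∈-doubleSet⁺ʳ a∈A , ∈-doubleSet⁺ʳ b∈A ,
        trans (i-j≡k⇒i≡k+j (i-j≡k⇒i≡k+j z-2N≡)) (eq a b N)
        where
        eq : ∀ a b N → a + b + N + N ≡ a + N + (b + N)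
        eq = solve-∀

    DiffSet-doubleSet : ∀ z → DiffSet (doubleSet A n) z ⇔ Thick (DiffSet A) (z + N)
    DiffSet-doubleSet z = mk⇔ to from
      where
      to : DiffSet (doubleSet A n) z → Thick (DiffSet A) (z + N)
      to (x , y , x∈ , y∈ , refl) with ∈-doubleSet⁻ x∈ | ∈-doubleSet⁻ y∈
      ... | inj₁ x∈A | inj₁ y∈A = inj₂ (inj₁ (x , y , x∈A , y∈A , i+j-j≡i (x - y) N))
      ... | inj₁ x∈A | inj₂ (b , b∈A , refl) = inj₁ (x , b , x∈A , b∈A , eq x b N)
        where
        eq : ∀ x b N → x - (b + N) + N ≡ x - b
        eq = solve-∀
      ... | inj₂ (a , a∈A , refl) | inj₁ y∈A = inj₂ (inj₂ (a , y , a∈A , y∈A , eq a y N))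
        where
        eq : ∀ a y N → a + N - y + N - N - N ≡ a - y
        eq = solve-∀
      ... | inj₂ (a , a∈A , refl) | inj₂ (b , b∈A , refl) = inj₂ (inj₁ (a , b , a∈A , b∈A , eq a b N))
        where
        eq : ∀ a b N → a + N - (b + N) + N - N ≡ a - b
        eq = solve-∀
      from : Thick (DiffSet A) (z + N) → DiffSet (doubleSet A n) z
      from (inj₁ (a , b , a∈A , b∈A , z+N≡)) =
        a , b + N , ∈-++⁺ˡ a∈A , ∈-doubleSet⁺ʳ b∈A , trans (i+j≡k⇒i≡k-j z+N≡) (eq a b N)
        where
        eq : ∀ a b N → a - b - N ≡ a - (b + N)
        eq = solve-∀
      from (inj₂ (inj₁ (a , b , a∈A , b∈A , z≡))) =
        a , b , ∈-++⁺ˡ a∈A , ∈-++⁺ˡ b∈A , trans (sym (i+j-j≡i z N)) z≡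
      from (inj₂ (inj₂ (a , b , a∈A , b∈A , z-N≡))) =
        a + N , b , ∈-doubleSet⁺ʳ a∈A , ∈-++⁺ˡ b∈A ,
        trans (i+j≡k⇒i≡k-j (i-j≡k⇒i≡k+j (i-j≡k⇒i≡k+j z-N≡))) (eq a b N)
        where
        eq : ∀ a b N → a - b + N + N - N ≡ a + N - b
        eq = solve-∀

module Reducible (A : List ℤ) (n : ℕ) .{{_ : NonZero n}} (m : ℤ) (A-max : IsLargest m A)
                 (A-red : ReducibleMod A n) where

  open Modulo n

  private
    characterisation : ∀ {x} → x ∈ A → + 0 ≤ x × x ≤ m × Reduction A n (x %ℕ n)
    characterisation = Equivalence.to (A-red m A-max _)

    ≥0 : ∀ {x} → x ∈ A → + 0 ≤ x
    ≥0 = proj₁ ∘ characterisation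

    ≤m : ∀ {x} → x ∈ A → x ≤ m
    ≤m = proj₂ A-max _

    reduction : ∀ {x} → x ∈ A → Reduction A n (x %ℕ n)
    reduction = proj₂ ∘ proj₂ ∘ characterisation

    +N∈ : ∀ {a} → a ∈ A → a + N ≤ m → a + N ∈ A
    +N∈ {a} a∈A a+N≤m = Equivalence.from (A-red m A-max (a + N))
      (≤-trans (≥0 a∈A) (<⇒≤ (i<i+N a)) , a+N≤m ,
       subst (Reduction A n) (sym ([i+N]%ℕn≡i%ℕn a)) (reduction a∈A))

    -N∈ : ∀ {a} → a ∈ A → + 0 ≤ a - N → a - N ∈ A
    -N∈ {a} a∈A 0≤a-N = Equivalence.from (A-red m A-max (a - N))
      (0≤a-N , ≤-trans (<⇒≤ (i-N<i a)) (≤m a∈A) ,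
       subst (Reduction A n) (sym ([i-N]%ℕn≡i%ℕn a)) (reduction a∈A))

  SumSet-convex : Convex (SumSet A)
  SumSet-convex (a , b , a∈A , b∈A , refl) (c , d , c∈A , d∈A , refl) x<y x≡y
    with a + N ≤? m | b + N ≤? m
  ... | yes a+N≤m | _ = a + N , b , +N∈ a∈A a+N≤m , b∈A , eq a b N
    where
    eq : ∀ a b N → a + b + N ≡ a + N + b
    eq = solve-∀
  ... | no _ | yes b+N≤m = a , b + N , a∈A , +N∈ b∈A b+N≤m , +-assoc a b N
  ... | no a+N≰m | no b+N≰m = c , d , c∈A , d∈A , sym (%ℕ≡⇒≡+N x<y x≡y c+d<a+b+2N)
    where
    open ≤-Reasoning
    eq : ∀ a b N → a + N + (b + N) ≡ a + b + N + N
    eq = solve-∀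
    c+d<a+b+2N : c + d < a + b + N + N
    c+d<a+b+2N = begin-strict
      c + d             ≤⟨ +-mono-≤ (≤m c∈A) (≤m d∈A) ⟩
      m + m             <⟨ +-mono-< (≰⇒> a+N≰m) (≰⇒> b+N≰m) ⟩
      a + N + (b + N)   ≡⟨ eq a b N ⟩
      a + b + N + N     ∎

  DiffSet-convex : Convex (DiffSet A)
  DiffSet-convex (a , b , a∈A , b∈A , refl) (c , d , c∈A , d∈A , refl) x<y x≡y
    with a + N ≤? m | + 0 ≤? b - N
  ... | yes a+N≤m | _ = a + N , b , +N∈ a∈A a+N≤m , b∈A , eq a b N
    where
    eq : ∀ a b N → a - b + N ≡ a + N - b
    eq = solve-∀
  ... | no _ | yes 0≤b-N = a , b - N , a∈A , -N∈ b∈A 0≤b-N , eq a b N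
    where
    eq : ∀ a b N → a - b + N ≡ a - (b - N)
    eq = solve-∀
  ... | no a+N≰m | no 0≰b-N = c , d , c∈A , d∈A , sym (%ℕ≡⇒≡+N x<y x≡y c-d<a-b+2N)
    where
    open ≤-Reasoning
    eq : ∀ a b N → a + N ≡ a - b + N + N + (b - N)
    eq = solve-∀
    c-d<a-b+2N : c - d < a - b + N + N
    c-d<a-b+2N = begin-strict
      c - d                     ≤⟨ +-monoʳ-≤ c (neg-mono-≤ (≥0 d∈A)) ⟩
      c + + 0                   ≡⟨ +-identityʳ c ⟩
      c                         ≤⟨ ≤m c∈A ⟩
      m                         <⟨ ≰⇒> a+N≰m ⟩
      a + N                     ≡⟨ eq a b N ⟩
      a - b + N + N + (b - N)   <⟨ +-monoʳ-< (a - b + N + N) (≰⇒> 0≰b-N) ⟩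
      a - b + N + N + + 0       ≡⟨ +-identityʳ _ ⟩
      a - b + N + N             ∎

  ResidueSet-SumSet : ∀ t → ResidueSet (SumSet A) t ⇔ ModSumSet A n t
  ResidueSet-SumSet t = mk⇔
    (λ { (_ , (a , b , a∈A , b∈A , refl) , refl) →
         a %ℕ n , b %ℕ n , reduction a∈A , reduction b∈A , [i+j]%ℕn≡[i%ℕn+j%ℕn]%ℕn a b })
    (λ { (_ , _ , (a , a∈A , _ , _ , refl) , (b , b∈A , _ , _ , refl) , refl) →
         a + b , (a , b , a∈A , b∈A , refl) , [i+j]%ℕn≡[i%ℕn+j%ℕn]%ℕn a b })

  ResidueSet-DiffSet : ∀ t → ResidueSet (DiffSet A) t ⇔ ModDiffSet A n t
  ResidueSet-DiffSet t = mk⇔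
    (λ { (_ , (a , b , a∈A , b∈A , refl) , refl) →
         a %ℕ n , b %ℕ n , reduction a∈A , reduction b∈A , [i-j]%ℕn≡[i%ℕn-j%ℕn]%ℕn a b })
    (λ { (_ , _ , (a , a∈A , _ , _ , refl) , (b , b∈A , _ , _ , refl) , refl) →
         a - b , (a , b , a∈A , b∈A , refl) , [i-j]%ℕn≡[i%ℕn-j%ℕn]%ℕn a b })

size-identity : ∀ {sA dA sB dB sR dR u v} →
                sB ≡ sA ℕ.+ (u ℕ.+ u) → dB ≡ dA ℕ.+ (v ℕ.+ v) → sR ≡ u → dR ≡ v →
                + sB - + dB ≡ (+ sA - + dA) + + 2 * (+ sR - + dR)
size-identity {sA} {dA} {u = u} {v} refl refl refl refl = regroup (+ sA) (+ dA) (+ u) (+ v)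
  where
  regroup : ∀ a b c d → (a + (c + c)) - (b + (d + d)) ≡ (a - b) + + 2 * (c - d)
  regroup = solve-∀

lemma7 : (A : List ℤ) (n : ℕ) .{{_ : NonZero n}} →
         Normalised A → ReducibleMod A n →
         Normalised (doubleSet A n) ×
         (∀ sA dA sB dB sR dR →
            HasSize (SumSet A) sA → HasSize (DiffSet A) dA →
            HasSize (SumSet (doubleSet A n)) sB → HasSize (DiffSet (doubleSet A n)) dB →
            HasSize (ModSumSet A n) sR → HasSize (ModDiffSet A n) dR →
            (+ sB - + dB) ≡ (+ sA - + dA) + + 2 * (+ sR - + dR))
lemma7 A n A-norm A-red =
  doubleSet-normalised A n A-norm ,
  λ sA dA sB dB sR dR hA⁺ hA⁻ hB⁺ hB⁻ hR⁺ hR⁻ →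
    let u , hTop⁺ = HasSize-Top hA⁺
        v , hTop⁻ = HasSize-Top hA⁻
    in size-identity {sA} {dA}
         (HasSize-unique hB⁺ (HasSize-cong (⇔-sym ∘ SumSet-doubleSet)
                               (HasSize-Thick SumSet-convex hA⁺ hTop⁺)))
         (HasSize-unique hB⁻ (HasSize-cong (⇔-sym ∘ DiffSet-doubleSet)
                               (HasSize-translate N (HasSize-Thick DiffSet-convex hA⁻ hTop⁻))))
         (HasSize-unique hR⁺ (HasSize-cong ResidueSet-SumSet
                               (HasSize-ResidueSet SumSet-convex hA⁺ hTop⁺)))
         (HasSize-unique hR⁻ (HasSize-cong ResidueSet-DiffSet
                               (HasSize-ResidueSet DiffSet-convex hA⁻ hTop⁻)))
  where
  open Modulo n
  open Reducible A n (max (+ 0) A) (max-IsLargest A (proj₁ A-norm)) A-red
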